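{- Let $G$ be a forbidden induced subgraph for the class of edge-apex cographs such that $G$ contains two vertex-disjoint induced copies of $P_4$. Then $G$ is isomorphic to one of the following three graphs, each on vertex set $\{a,b,c,d,1,2,3,4\}$ and each containing the edges $ab,bc,cd,12,23,34$: (a) the graph with no further edges (the disjoint union of two copies of $P_4$); (b) the graph whose further edges are all eight edges joining a vertex of $\{b,c\}$ to a vertex of $\{1,2,3,4\}$; (c) the graph whose further edges are all sixteen edges joining a vertex of $\{a,b,c,d\}$ to a vertex of $\{1,2,3,4\}$ (the join of two copies of $P_4$).
   Context: All graphs are finite, simple and undirected. $P_4$ is the path on four vertices. A cograph is a graph with no induced subgraph isomorphic to $P_4$ (equivalently, generated from $K_1$ by complementation and disjoint union). A graph $G$ is an edge-apex cograph if $G$ is a cograph or $G$ has an edge $e$ such that $G-e$ (delete the edge, keep all vertices) is a cograph. A forbidden induced subgraph for the class of edge-apex cographs is a graph that is not an edge-apex cograph but all of whose proper induced subgraphs are edge-apex cographs. -}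

module Defs where

open import Data.Nat using (ℕ; _<_; _<ᵇ_; _∸_; ∣_-_∣; _≡ᵇ_)
open import Data.Bool using (Bool; true; false; _∧_; _∨_; not; if_then_else_; _xor_)
import Data.Bool.Properties as BoolP
open import Data.Fin using (Fin; toℕ)
open import Data.Fin.Properties using (_≟_; all?)
open import Data.Product using (Σ; ∃; ∃-syntax; _×_; _,_)
open import Data.Sum using (_⊎_)
open import Relation.Nullary using (¬_; does)
open import Relation.Nullary.Decidable using (from-yes)
open import Relation.Binary.PropositionalEquality using (_≡_; refl)
open import Function.Definitions using (Injective; Bijective)

Adj : ℕ → Set
Adj n = Fin n → Fin n → Bool

record Graph : Set where
  field
    n      : ℕ
    adj    : Adj n
    sym    : ∀ x y → adj x y ≡ adj y x
    irrefl : ∀ x → adj x x ≡ false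
open Graph public

P4adj : Adj 4
P4adj x y = ∣ toℕ x - toℕ y ∣ ≡ᵇ 1

InducedCopy : ∀ {n m} → Adj n → Adj m → (Fin m → Fin n) → Set
InducedCopy adj H f = Injective _≡_ _≡_ f × (∀ i j → adj (f i) (f j) ≡ H i j)

HasInducedP4 : ∀ {n} → Adj n → Set
HasInducedP4 adj = ∃[ f ] InducedCopy adj P4adj f

IsCographAdj : ∀ {n} → Adj n → Set
IsCographAdj adj = ¬ HasInducedP4 adj

IsCograph : Graph → Set
IsCograph G = IsCographAdj (adj G)

deleteEdge : ∀ {n} → Adj n → Fin n → Fin n → Adj n
deleteEdge adj u v x y =
  adj x y ∧ not ((does (x ≟ u) ∧ does (y ≟ v)) ∨ (does (x ≟ v) ∧ does (y ≟ u)))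

EdgeApexCograph : Graph → Set
EdgeApexCograph G =
  IsCograph G ⊎ (Σ (Fin (n G)) λ u → Σ (Fin (n G)) λ v →
                   (adj G u v ≡ true) × IsCographAdj (deleteEdge (adj G) u v))

induced : (G : Graph) {m : ℕ} → (Fin m → Fin (n G)) → Graph
induced G {m} f = record
  { n = m
  ; adj = λ i j → adj G (f i) (f j)
  ; sym = λ i j → sym G (f i) (f j)
  ; irrefl = λ i → irrefl G (f i) }

-- forbidden induced subgraph (minimal non-member) for edge-apex cographs:
-- G is not an edge-apex cograph, but every proper induced subgraph
-- (induced on an m-element vertex subset with m < |V(G)|) is.
ForbiddenEdgeApex : Graph → Set
ForbiddenEdgeApex G =
  ¬ EdgeApexCograph G ×
  (∀ m → m < n G → (f : Fin m → Fin (n G)) → Injective _≡_ _≡_ f →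
     EdgeApexCograph (induced G f))

TwoDisjointInducedP4 : Graph → Set
TwoDisjointInducedP4 G =
  Σ (Fin 4 → Fin (n G)) λ f → Σ (Fin 4 → Fin (n G)) λ g →
    InducedCopy (adj G) P4adj f × InducedCopy (adj G) P4adj g ×
    (∀ i j → ¬ (f i ≡ g j))

_≅_ : Graph → Graph → Set
G ≅ H = Σ (Fin (n G) → Fin (n H)) λ f →
  Bijective _≡_ _≡_ f × (∀ x y → adj H (f x) (f y) ≡ adj G x y)

-- The three target graphs on vertex set Fin 8, where
-- 0,1,2,3 stand for a,b,c,d and 4,5,6,7 stand for 1,2,3,4.
letter : Fin 8 → Bool
letter x = toℕ x <ᵇ 4

pos : Fin 8 → ℕ
pos x = if letter x then toℕ x else toℕ x ∸ 4

pathEdges : Adj 8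
pathEdges x y = not (letter x xor letter y) ∧ (∣ pos x - pos y ∣ ≡ᵇ 1)

cross : Adj 8
cross x y = letter x xor letter y

midLetter : Fin 8 → Bool
midLetter x = letter x ∧ ((pos x ≡ᵇ 1) ∨ (pos x ≡ᵇ 2))

adjA adjB adjC : Adj 8
adjA = pathEdges
adjB x y = pathEdges x y ∨ (cross x y ∧ (midLetter x ∨ midLetter y))
adjC x y = pathEdges x y ∨ cross x y

symDec : (a : Adj 8) → _
symDec a = all? λ x → all? λ y → a x y BoolP.≟ a y x

irrDec : (a : Adj 8) → _
irrDec a = all? λ x → a x x BoolP.≟ false

graphA : Graph
graphA = record { n = 8 ; adj = adjA
                ; sym = from-yes (symDec adjA) ; irrefl = from-yes (irrDec adjA) }

graphB : Graph
graphB = record { n = 8 ; adj = adjB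
                ; sym = from-yes (symDec adjB) ; irrefl = from-yes (irrDec adjB) }

graphC : Graph
graphC = record { n = 8 ; adj = adjC
                ; sym = from-yes (symDec adjC) ; irrefl = from-yes (irrDec adjC) }

{-# OPTIONS --safe #-}
-- The two disjoint P4s span an 8-vertex induced subgraph that is not an edge-apex cograph:
-- deleting an edge destroys exactly the induced P4s that use it, and no edge lies on both.
-- By minimality these 8 vertices are all of G, so G is determined by the 4 × 4 pattern of
-- adjacencies between the two paths, and every G − x is an edge-apex cograph.  For all but
-- four patterns this fails for a suitable x, witnessed by induced P4s of G − x with no edge
-- common to all of them; the four survivors are the graphs (a), (b) (with either path in
-- the role of a b c d) and (c).
module Submission where

open import Defs hiding (sym)
open import Data.Bool using (Bool; true; false; _∧_; not)
import Data.Bool.Properties as Bool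
open import Data.Empty using (⊥-elim)
open import Data.Fin
  using (Fin; zero; suc; toℕ; inject₁; punchIn; punchOut; splitAt; join; _↑ˡ_; _↑ʳ_)
open import Data.Fin.Properties
  using ( _≟_; all?; any?; punchIn-injective; punchIn-punchOut; punchOut-injective
        ; injective⇒≤; join-splitAt )
open import Data.Nat using (ℕ; suc; _≤_; _≡ᵇ_)
open import Data.Nat.Properties using (≤-refl; <⇒≱; ≮⇒≥; ∣-∣-comm; ∣n-n∣≡0)
open import Data.Product using (Σ; ∃-syntax; _×_; _,_; proj₁; proj₂)
open import Data.Sum using (_⊎_; inj₁; inj₂)
import Data.Sum as Sum
open import Data.Vec using (Vec; _∷_; []; lookup; tabulate)
open import Data.Vec.Properties using (lookup∘tabulate)
open import Function using (_∘_; id)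
open import Function.Definitions using (Injective; Surjective)
open import Function.Consequences.Propositional using (strictlySurjective⇒surjective)
import Function.Construct.Composition as Composition
import Function.Construct.Symmetry as Symmetry
open import Relation.Nullary using (¬_; Dec; yes; no; does; contradiction)
open import Relation.Nullary.Decidable
  using ( True; toWitness; from-yes; map′; _×-dec_; _⊎-dec_; _→-dec_; ¬?
        ; dec-true; dec-false )
open import Relation.Binary.PropositionalEquality
  using (_≡_; _≢_; refl; sym; trans; cong; cong₂)

private
  variable
    K N : ℕ

EdgeApexCographAdj : Adj N → Set
EdgeApexCographAdj {N} A =
  IsCographAdj A ⊎ (Σ (Fin N) λ u → Σ (Fin N) λ v →
                      (A u v ≡ true) × IsCographAdj (deleteEdge A u v))

infix 4 _≗₂_
_≗₂_ : Adj N → Adj N → Set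
A ≗₂ B = ∀ x y → A x y ≡ B x y

hasInducedP4-resp : {A B : Adj N} → A ≗₂ B → HasInducedP4 A → HasInducedP4 B
hasInducedP4-resp A≗B (q , q-inj , q-adj) =
  q , q-inj , λ i j → trans (sym (A≗B (q i) (q j))) (q-adj i j)

deleteEdge-resp : {A B : Adj N} → A ≗₂ B → ∀ u v → deleteEdge A u v ≗₂ deleteEdge B u v
deleteEdge-resp A≗B u v x y = cong (_∧ _) (A≗B x y)

edgeApex-resp : {A B : Adj N} → A ≗₂ B → EdgeApexCographAdj A → EdgeApexCographAdj B
edgeApex-resp A≗B (inj₁ cograph) =
  inj₁ (cograph ∘ hasInducedP4-resp (λ x y → sym (A≗B x y)))
edgeApex-resp A≗B (inj₂ (u , v , uv , cograph)) =
  inj₂ (u , v , trans (sym (A≗B u v)) uv ,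
        cograph ∘ hasInducedP4-resp (λ x y → sym (deleteEdge-resp A≗B u v x y)))

pointwise? : (A B : Adj N) → Dec (A ≗₂ B)
pointwise? A B = all? λ x → all? λ y → A x y Bool.≟ B x y

injective? : (f : Fin K → Fin N) → Dec (Injective _≡_ _≡_ f)
injective? f = map′ (λ inj → inj _ _) (λ inj _ _ → inj)
                    (all? λ i → all? λ j → (f i ≟ f j) →-dec (i ≟ j))

inducedCopy? : (A : Adj N) (H : Adj K) (f : Fin K → Fin N) → Dec (InducedCopy A H f)
inducedCopy? A H f = injective? f ×-dec pointwise? (λ i j → A (f i) (f j)) H

P4adj-sym : ∀ i j → P4adj i j ≡ P4adj j i
P4adj-sym i j = cong (_≡ᵇ 1) (∣-∣-comm (toℕ i) (toℕ j))

P4adj-irrefl : ∀ i → P4adj i i ≡ false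
P4adj-irrefl i = cong (_≡ᵇ 1) (∣n-n∣≡0 (toℕ i))

SameEdge : Fin N → Fin N → Fin N → Fin N → Set
SameEdge x y u v = (x ≡ u × y ≡ v) ⊎ (x ≡ v × y ≡ u)

sameEdge? : (x y u v : Fin N) → Dec (SameEdge x y u v)
sameEdge? x y u v = ((x ≟ u) ×-dec (y ≟ v)) ⊎-dec ((x ≟ v) ×-dec (y ≟ u))

sameEdge-map : ∀ {a b i j : Fin K} {u v : Fin N} (q : Fin K → Fin N) →
               SameEdge a b i j → SameEdge (q i) (q j) u v → SameEdge (q a) (q b) u v
sameEdge-map q (inj₁ (refl , refl)) same                 = same
sameEdge-map q (inj₂ (refl , refl)) (inj₁ (qi≡u , qj≡v)) = inj₂ (qj≡v , qi≡u)
sameEdge-map q (inj₂ (refl , refl)) (inj₂ (qi≡v , qj≡u)) = inj₁ (qj≡u , qi≡v)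

UsesEdge : (Fin 4 → Fin N) → Fin N → Fin N → Set
UsesEdge q u v = ∃[ k ] SameEdge (q (inject₁ k)) (q (suc k)) u v

usesEdge? : (q : Fin 4 → Fin N) (u v : Fin N) → Dec (UsesEdge q u v)
usesEdge? q u v = any? λ k → sameEdge? (q (inject₁ k)) (q (suc k)) u v

P4adj-edge : ∀ i j → P4adj i j ≡ true → UsesEdge id i j
P4adj-edge = from-yes (all? λ i → all? λ j → (P4adj i j Bool.≟ true) →-dec usesEdge? id i j)

module _ (A : Adj N) {u v : Fin N} where

  deleteEdge-unchanged : ∀ {x y} → ¬ SameEdge x y u v → deleteEdge A u v x y ≡ A x y
  deleteEdge-unchanged {x} {y} ¬same =
    trans (cong (λ b → A x y ∧ not b) (dec-false (sameEdge? x y u v) ¬same))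
          (Bool.∧-identityʳ (A x y))

  deleteEdge-nonedge : ∀ {x y} → A x y ≡ false → deleteEdge A u v x y ≡ false
  deleteEdge-nonedge xy = cong (_∧ _) xy

  deleteEdge-sameEdge : ∀ {x y} → SameEdge x y u v → deleteEdge A x y ≗₂ deleteEdge A u v
  deleteEdge-sameEdge (inj₁ (refl , refl)) p q = refl
  deleteEdge-sameEdge (inj₂ (refl , refl)) p q =
    cong (λ b → A p q ∧ not b)
         (Bool.∨-comm (does (p ≟ v) ∧ does (q ≟ u)) (does (p ≟ u) ∧ does (q ≟ v)))

  deleteEdge-preserves : ∀ {q} → ¬ UsesEdge q u v →
                         InducedCopy A P4adj q → InducedCopy (deleteEdge A u v) P4adj q
  deleteEdge-preserves {q} ¬uses (q-inj , q-adj) =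
    q-inj , λ i j → trans (unchanged i j) (q-adj i j)
    where
    unchanged : ∀ i j → deleteEdge A u v (q i) (q j) ≡ A (q i) (q j)
    unchanged i j with P4adj i j in ij
    ... | false = let nonedge = trans (q-adj i j) ij in
                  trans (deleteEdge-nonedge nonedge) (sym nonedge)
    ... | true  = deleteEdge-unchanged λ same →
                    let k , edge = P4adj-edge i j ij in ¬uses (k , sameEdge-map q edge same)

-- Deleting an edge uv destroys the induced copy Q only if uv is one of the edges of Q.
¬edgeApex-viaP4 : (A : Adj N) (Q : Fin 4 → Fin N) → InducedCopy A P4adj Q →
                  (∀ k → HasInducedP4 (deleteEdge A (Q (inject₁ k)) (Q (suc k)))) →
                  ¬ EdgeApexCographAdj A
¬edgeApex-viaP4 A Q Q-copy _ (inj₁ cograph) = cograph (Q , Q-copy)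
¬edgeApex-viaP4 A Q Q-copy survivor (inj₂ (u , v , _ , cograph)) with usesEdge? Q u v
... | no ¬uses       = cograph (Q , deleteEdge-preserves A ¬uses Q-copy)
... | yes (k , same) = cograph (hasInducedP4-resp (deleteEdge-sameEdge A same) (survivor k))

¬edgeApex-twoDisjointP4 : (A : Adj N) {f g : Fin 4 → Fin N} →
                          InducedCopy A P4adj f → InducedCopy A P4adj g →
                          (∀ i j → f i ≢ g j) → ¬ EdgeApexCographAdj A
¬edgeApex-twoDisjointP4 A {f} {g} f-copy g-copy disjoint =
  ¬edgeApex-viaP4 A f f-copy λ k → g , deleteEdge-preserves A (g-avoids k) g-copy
  where
  g-avoids : ∀ k → ¬ UsesEdge g (f (inject₁ k)) (f (suc k))
  g-avoids k (l , inj₁ (g≡f , _)) = disjoint (inject₁ k) (inject₁ l) (sym g≡f)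
  g-avoids k (l , inj₂ (g≡f , _)) = disjoint (suc k) (inject₁ l) (sym g≡f)

infixl 5 _∖_
_∖_ : Adj (suc N) → Fin (suc N) → Adj N
(A ∖ x) i j = A (punchIn x i) (punchIn x j)

Avoids : Fin (suc N) → (Fin K → Fin (suc N)) → Set
Avoids x q = ∀ i → x ≢ q i

avoids? : (x : Fin (suc N)) (q : Fin K → Fin (suc N)) → Dec (Avoids x q)
avoids? x q = all? λ i → ¬? (x ≟ q i)

inducedCopy-∖ : (A : Adj (suc N)) {H : Adj K} {x : Fin (suc N)} {q : Fin K → Fin (suc N)} →
                (avoids : Avoids x q) → InducedCopy A H q →
                InducedCopy (A ∖ x) H (λ i → punchOut (avoids i))
inducedCopy-∖ A avoids (q-inj , q-adj) =
  (λ eq → q-inj (punchOut-injective (avoids _) (avoids _) eq)) ,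
  λ i j → trans (cong₂ A (punchIn-punchOut (avoids i)) (punchIn-punchOut (avoids j)))
                (q-adj i j)

does-≟-punchIn : ∀ (x : Fin (suc N)) i j → does (punchIn x i ≟ punchIn x j) ≡ does (i ≟ j)
does-≟-punchIn x i j with i ≟ j
... | yes refl = dec-true (punchIn x i ≟ punchIn x i) refl
... | no  i≢j  = dec-false (punchIn x i ≟ punchIn x j) (i≢j ∘ punchIn-injective x i j)

deleteEdge-∖ : (A : Adj (suc N)) (x : Fin (suc N)) {u v : Fin N} {u′ v′ : Fin (suc N)} →
               punchIn x u ≡ u′ → punchIn x v ≡ v′ →
               deleteEdge (A ∖ x) u v ≗₂ deleteEdge A u′ v′ ∖ x
deleteEdge-∖ A x {u} {v} refl refl i j
  rewrite does-≟-punchIn x i u | does-≟-punchIn x j v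
        | does-≟-punchIn x i v | does-≟-punchIn x j u = refl

Obstruction : Adj (suc N) → Fin (suc N) →
              (Fin 4 → Fin (suc N)) → (Fin 3 → Fin 4 → Fin (suc N)) → Set
Obstruction A x Q T =
  (Avoids x Q × InducedCopy A P4adj Q) ×
  (∀ k → Avoids x (T k) × InducedCopy (deleteEdge A (Q (inject₁ k)) (Q (suc k))) P4adj (T k))

obstruction? : ∀ A x Q T → Dec (Obstruction {N} A x Q T)
obstruction? A x Q T =
  (avoids? x Q ×-dec inducedCopy? A P4adj Q) ×-dec
  all? λ k → avoids? x (T k) ×-dec
             inducedCopy? (deleteEdge A (Q (inject₁ k)) (Q (suc k))) P4adj (T k)

¬edgeApex-∖ : ∀ A x Q T → Obstruction {N} A x Q T → ¬ EdgeApexCographAdj (A ∖ x)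
¬edgeApex-∖ A x Q T ((Q-avoids , Q-copy) , survivor) =
  ¬edgeApex-viaP4 (A ∖ x) Q′ (inducedCopy-∖ A Q-avoids Q-copy) survivor′
  where
  Q′ : Fin 4 → Fin _
  Q′ i = punchOut (Q-avoids i)
  survivor′ : ∀ k → HasInducedP4 (deleteEdge (A ∖ x) (Q′ (inject₁ k)) (Q′ (suc k)))
  survivor′ k =
    let T-avoids , T-copy = survivor k in
    hasInducedP4-resp
      (λ i j → sym (deleteEdge-∖ A x (punchIn-punchOut _) (punchIn-punchOut _) i j))
      (_ , inducedCopy-∖ (deleteEdge A _ _) T-avoids T-copy)

injective⇒surjective : {f : Fin K → Fin N} → Injective _≡_ _≡_ f → N ≤ K →
                       Surjective _≡_ _≡_ f
injective⇒surjective {K} {suc N} {f} f-inj N≤K = strictlySurjective⇒surjective hit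
  where
  hit : ∀ y → ∃[ x ] f x ≡ y
  hit y with any? (λ x → f x ≟ y)
  ... | yes found = found
  ... | no ¬found = contradiction (injective⇒≤ f′-inj) (<⇒≱ N≤K)
    where
    y≢f : ∀ x → y ≢ f x
    y≢f x y≡fx = ¬found (x , sym y≡fx)
    f′-inj : Injective _≡_ _≡_ (λ x → punchOut (y≢f x))
    f′-inj eq = f-inj (punchOut-injective (y≢f _) (y≢f _) eq)

embedding⇒≅ : (G H : Graph) (φ : Fin (n G) → Fin (n H)) →
              Injective _≡_ _≡_ φ → n H ≤ n G →
              (∀ x y → adj H (φ x) (φ y) ≡ adj G x y) → G ≅ H
embedding⇒≅ G H φ φ-inj ≤ φ-adj = φ , (φ-inj , injective⇒surjective φ-inj ≤) , φ-adj

≅-sym : {G H : Graph} → G ≅ H → H ≅ G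
≅-sym {G} {H} (φ , φ-bij , φ-adj) =
  φ⁻¹ , Symmetry.bijective φ-bij refl sym trans (cong φ) , φ⁻¹-adj
  where
  φ⁻¹ : Fin (n H) → Fin (n G)
  φ⁻¹ y = proj₁ (proj₂ φ-bij y)
  φφ⁻¹ : ∀ y → φ (φ⁻¹ y) ≡ y
  φφ⁻¹ y = proj₂ (proj₂ φ-bij y) refl
  φ⁻¹-adj : ∀ x y → adj G (φ⁻¹ x) (φ⁻¹ y) ≡ adj H x y
  φ⁻¹-adj x y = trans (sym (φ-adj (φ⁻¹ x) (φ⁻¹ y))) (cong₂ (adj H) (φφ⁻¹ x) (φφ⁻¹ y))

≅-trans : {G H J : Graph} → G ≅ H → H ≅ J → G ≅ J
≅-trans (φ , φ-bij , φ-adj) (ψ , ψ-bij , ψ-adj) =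
  ψ ∘ φ , Composition.bijective _≡_ _≡_ _≡_ φ-bij ψ-bij ,
  λ x y → trans (ψ-adj (φ x) (φ y)) (φ-adj x y)

-- Row i, column j: the adjacency between vertex i of the first P4 and vertex j of the second.
Cross : Set
Cross = Vec (Vec Bool 4) 4

entry : Cross → Fin 4 → Fin 4 → Bool
entry M i j = lookup (lookup M i) j

twoP4s⊎ : Cross → Fin 4 ⊎ Fin 4 → Fin 4 ⊎ Fin 4 → Bool
twoP4s⊎ M (inj₁ i) (inj₁ j) = P4adj i j
twoP4s⊎ M (inj₂ i) (inj₂ j) = P4adj i j
twoP4s⊎ M (inj₁ i) (inj₂ j) = entry M i j
twoP4s⊎ M (inj₂ j) (inj₁ i) = entry M i j

twoP4s : Cross → Adj 8
twoP4s M x y = twoP4s⊎ M (splitAt 4 x) (splitAt 4 y)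

twoP4s⊎-sym : ∀ M s t → twoP4s⊎ M s t ≡ twoP4s⊎ M t s
twoP4s⊎-sym M (inj₁ i) (inj₁ j) = P4adj-sym i j
twoP4s⊎-sym M (inj₂ i) (inj₂ j) = P4adj-sym i j
twoP4s⊎-sym M (inj₁ i) (inj₂ j) = refl
twoP4s⊎-sym M (inj₂ j) (inj₁ i) = refl

twoP4s⊎-irrefl : ∀ M s → twoP4s⊎ M s s ≡ false
twoP4s⊎-irrefl M (inj₁ i) = P4adj-irrefl i
twoP4s⊎-irrefl M (inj₂ i) = P4adj-irrefl i

twoP4sGraph : Cross → Graph
twoP4sGraph M = record
  { n      = 8
  ; adj    = twoP4s M
  ; sym    = λ x y → twoP4s⊎-sym M (splitAt 4 x) (splitAt 4 y)
  ; irrefl = λ x → twoP4s⊎-irrefl M (splitAt 4 x)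
  }

firstP4 secondP4 : Fin 4 → Fin 8
firstP4 i  = i ↑ˡ 4
secondP4 i = 4 ↑ʳ i

¬edgeApex-twoP4s : ∀ M → ¬ EdgeApexCographAdj (twoP4s M)
¬edgeApex-twoP4s M =
  ¬edgeApex-twoDisjointP4 (twoP4s M)
    (from-yes (inducedCopy? (twoP4s M) P4adj firstP4))
    (from-yes (inducedCopy? (twoP4s M) P4adj secondP4))
    (from-yes (all? λ i → all? λ j → ¬? (firstP4 i ≟ secondP4 j)))

pattern ○ = false
pattern ● = true
pattern row p q r s = p ∷ q ∷ r ∷ s ∷ []

pattern a = zero
pattern b = suc a
pattern c = suc b
pattern d = suc c
pattern ① = suc d
pattern ② = suc ①
pattern ③ = suc ②
pattern ④ = suc ③

pattern crossA  = row ○ ○ ○ ○ ∷ row ○ ○ ○ ○ ∷ row ○ ○ ○ ○ ∷ row ○ ○ ○ ○ ∷ []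
pattern crossB  = row ○ ○ ○ ○ ∷ row ● ● ● ● ∷ row ● ● ● ● ∷ row ○ ○ ○ ○ ∷ []
pattern crossB′ = row ○ ● ● ○ ∷ row ○ ● ● ○ ∷ row ○ ● ● ○ ∷ row ○ ● ● ○ ∷ []
pattern crossC  = row ● ● ● ● ∷ row ● ● ● ● ∷ row ● ● ● ● ∷ row ● ● ● ● ∷ []

crossA≅graphA : twoP4sGraph crossA ≅ graphA
crossA≅graphA = embedding⇒≅ (twoP4sGraph crossA) graphA id id ≤-refl
                  (from-yes (pointwise? adjA (twoP4s crossA)))

crossB≅graphB : twoP4sGraph crossB ≅ graphB
crossB≅graphB = embedding⇒≅ (twoP4sGraph crossB) graphB id id ≤-refl
                  (from-yes (pointwise? adjB (twoP4s crossB)))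

swapP4s : Fin 8 → Fin 8
swapP4s x = join 4 4 (Sum.swap (splitAt 4 x))

crossB′≅graphB : twoP4sGraph crossB′ ≅ graphB
crossB′≅graphB =
  embedding⇒≅ (twoP4sGraph crossB′) graphB swapP4s (from-yes (injective? swapP4s)) ≤-refl
    (from-yes (pointwise? (λ x y → adjB (swapP4s x) (swapP4s y)) (twoP4s crossB′)))

crossC≅graphC : twoP4sGraph crossC ≅ graphC
crossC≅graphC = embedding⇒≅ (twoP4sGraph crossC) graphC id id ≤-refl
                  (from-yes (pointwise? adjC (twoP4s crossC)))

otherP4 : Fin 8 → Fin 4 → Fin 8
otherP4 x = Sum.[ (λ _ → secondP4) , (λ _ → firstP4) ]′ (splitAt 4 x)

path : Fin 8 → Fin 8 → Fin 8 → Fin 8 → Fin 4 → Fin 8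
path p q r s = lookup (p ∷ q ∷ r ∷ s ∷ [])

-- T k is an induced P4 surviving the deletion of x and of the k-th edge of otherP4 x.  Each
-- certificate reads only entries that its clause of classify fixes, so evaluation decides it.
refute : ∀ {M} {B : Set} → (∀ x → EdgeApexCographAdj (twoP4s M ∖ x)) →
         (x : Fin 8) (T₀ T₁ T₂ : Fin 4 → Fin 8) →
         {True (obstruction? (twoP4s M) x (otherP4 x) (lookup (T₀ ∷ T₁ ∷ T₂ ∷ [])))} → B
refute {M} deletable x T₀ T₁ T₂ {ok} =
  ⊥-elim (¬edgeApex-∖ (twoP4s M) x (otherP4 x) (lookup (T₀ ∷ T₁ ∷ T₂ ∷ []))
                      (toWitness ok) (deletable x))

classify : ∀ M → (∀ x → EdgeApexCographAdj (twoP4s M ∖ x)) →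
           twoP4sGraph M ≅ graphA ⊎ twoP4sGraph M ≅ graphB ⊎ twoP4sGraph M ≅ graphC
classify crossA _ = inj₁ crossA≅graphA
classify (row ○ ○ ○ ○ ∷ row ○ ○ ○ ○ ∷ row ○ ○ ○ ○ ∷ row ○ ○ ○ ● ∷ []) H =
  refute H a (path b c d ④) (path b c d ④) (path b c d ④)
classify (row ○ ○ ○ ○ ∷ row ○ ○ ○ ○ ∷ row ○ ○ ○ ○ ∷ row ○ ○ ● _ ∷ []) H =
  refute H a (path b c d ③) (path b c d ③) (path b c d ③)
classify (row ○ ○ ○ ○ ∷ row ○ ○ ○ ○ ∷ row ○ ○ ○ ○ ∷ row ○ ● _ _ ∷ []) H =
  refute H a (path b c d ②) (path b c d ②) (path b c d ②)
classify (row ○ ○ ○ ○ ∷ row ○ ○ ○ ○ ∷ row ○ ○ ○ ● ∷ row ○ _ _ _ ∷ []) H =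
  refute H d (path a b c ④) (path a b c ④) (path a b c ④)
classify (row ○ ○ ○ ○ ∷ row ○ ○ ○ ○ ∷ row ○ ○ ● _ ∷ row ○ _ _ _ ∷ []) H =
  refute H d (path a b c ③) (path a b c ③) (path a b c ③)
classify (row ○ ○ ○ ○ ∷ row ○ ○ ○ ○ ∷ row ○ ● _ _ ∷ row ○ _ _ _ ∷ []) H =
  refute H d (path a b c ②) (path a b c ②) (path a b c ②)
classify (row ○ ○ ○ ○ ∷ row ○ ○ ○ ● ∷ row ○ _ _ _ ∷ row ○ _ _ _ ∷ []) H =
  refute H ① (path b ④ ③ ②) (path a b ④ ③) (path a b ④ ③)
classify (row ○ ○ ○ ○ ∷ row ○ ○ ● _ ∷ row ○ _ _ _ ∷ row ○ _ _ _ ∷ []) H =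
  refute H ④ (path b ③ ② ①) (path a b ③ ②) (path a b ③ ②)
classify (row ○ ○ ○ ○ ∷ row ○ ● ○ _ ∷ row ○ _ _ _ ∷ row ○ _ _ _ ∷ []) H =
  refute H c (path a b ② ③) (path a b ② ①) (path a b ② ①)
classify (row ○ ○ ○ ○ ∷ row ○ ● ● ○ ∷ row ○ _ _ _ ∷ row ○ _ _ _ ∷ []) H =
  refute H c (path a b ③ ④) (path a b ② ①) (path a b ② ①)
classify (row ○ ○ ○ ○ ∷ row ○ ● ● ● ∷ row ○ _ _ _ ∷ row ○ _ _ _ ∷ []) H =
  refute H ③ (path ① ② b ④) (path a b ② ①) (path a b ② ①)
classify (row ○ ○ ○ ○ ∷ row ○ _ _ _ ∷ row ○ _ _ _ ∷ row ● _ _ _ ∷ []) H =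
  refute H a (path b c d ①) (path b c d ①) (path b c d ①)
classify (row ○ ○ ○ ○ ∷ row ○ _ _ _ ∷ row ● _ _ _ ∷ row _ _ _ _ ∷ []) H =
  refute H d (path a b c ①) (path a b c ①) (path a b c ①)
classify (row ○ ○ ○ ○ ∷ row ● _ _ _ ∷ row ○ _ _ _ ∷ row ○ _ _ _ ∷ []) H =
  refute H a (path d c b ①) (path d c b ①) (path d c b ①)
classify (row ○ ○ ○ ○ ∷ row ● ○ ○ _ ∷ row ● _ _ _ ∷ row ○ _ _ _ ∷ []) H =
  refute H ④ (path b ① ② ③) (path a b ① c) (path a b ① ②)
classify (row ○ ○ ○ ○ ∷ row ● ○ ● _ ∷ row ● _ _ _ ∷ row ○ _ _ _ ∷ []) H =
  refute H c (path a b ③ ②) (path a b ① ②) (path a b ① ②)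
classify (row ○ ○ ○ ○ ∷ row ● ● _ _ ∷ row ● ○ _ _ ∷ row ○ ○ _ _ ∷ []) H =
  refute H a (path d c b ②) (path d c b ②) (path d c b ②)
classify (row ○ ○ ○ ○ ∷ row ● ● ○ ○ ∷ row ● ● _ _ ∷ row ○ ○ ○ ○ ∷ []) H =
  refute H ① (path b ② ③ ④) (path a b ② c) (path a b ② ③)
classify (row ○ ○ ○ ○ ∷ row ● ● ○ ● ∷ row ● ● _ _ ∷ row ○ ○ ○ ○ ∷ []) H =
  refute H a (path ① b ② ③) (path ① b ④ ③) (path ③ ② b ④)
classify (row ○ ○ ○ ○ ∷ row ● ● ● ○ ∷ row ● ● _ _ ∷ row ○ ○ ○ ○ ∷ []) H =
  refute H ② (path ① b ③ ④) (path a b ① c) (path a b ③ ④)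
classify (row ○ ○ ○ ○ ∷ row ● ● ● ● ∷ row ● ● ○ _ ∷ row ○ ○ ○ ○ ∷ []) H =
  refute H a (path d c b ③) (path d c b ③) (path d c b ③)
classify (row ○ ○ ○ ○ ∷ row ● ● ● ● ∷ row ● ● ● ○ ∷ row ○ ○ ○ ○ ∷ []) H =
  refute H a (path d c b ④) (path d c b ④) (path d c b ④)
classify crossB _ = inj₂ (inj₁ crossB≅graphB)
classify (row ○ ○ ○ ○ ∷ row ● ● _ _ ∷ row ● ● _ _ ∷ row ○ ○ ○ ● ∷ []) H =
  refute H ① (path d ④ ③ ②) (path a b ② c) (path d ④ ③ ②)
classify (row ○ ○ ○ ○ ∷ row ● ● _ _ ∷ row ● ● _ _ ∷ row ○ ○ ● _ ∷ []) H =
  refute H ④ (path d ③ ② ①) (path a b ① c) (path d ③ ② ①)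
classify (row ○ ○ ○ ○ ∷ row ● ● _ _ ∷ row ● _ _ _ ∷ row ○ ● _ _ ∷ []) H =
  refute H c (path a b ② d) (path a b ② d) (path a b ② d)
classify (row ○ ○ ○ ○ ∷ row ● _ _ _ ∷ row _ _ _ _ ∷ row ● _ _ _ ∷ []) H =
  refute H c (path a b ① d) (path a b ① d) (path a b ① d)
classify (row ○ ○ ○ ● ∷ row _ _ _ _ ∷ row _ _ _ _ ∷ row _ _ _ _ ∷ []) H =
  refute H ① (path a ④ ③ ②) (path a ④ ③ ②) (path a ④ ③ ②)
classify (row ○ ○ ● _ ∷ row _ _ _ _ ∷ row _ _ _ _ ∷ row _ _ _ _ ∷ []) H =
  refute H ④ (path a ③ ② ①) (path a ③ ② ①) (path a ③ ② ①)
classify (row ○ ● ○ ○ ∷ row _ _ _ _ ∷ row _ _ _ _ ∷ row _ _ _ _ ∷ []) H =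
  refute H ① (path a ② ③ ④) (path a ② ③ ④) (path a ② ③ ④)
classify (row ○ ● ● ○ ∷ row ○ ○ _ _ ∷ row ○ ○ _ _ ∷ row ○ _ _ _ ∷ []) H =
  refute H d (path c b a ②) (path b a ② ①) (path b a ② ①)
classify (row ○ ● ● ○ ∷ row ○ ○ _ _ ∷ row ○ ● _ _ ∷ row ○ _ _ _ ∷ []) H =
  refute H ③ (path a ② c b) (path b a ② c) (path b a ② ①)
classify (row ○ ● ● ○ ∷ row ○ ● ○ ○ ∷ row ○ _ _ _ ∷ row ○ _ _ _ ∷ []) H =
  refute H ① (path b ② ③ ④) (path b a ③ ④) (path b a ③ ④)
classify (row ○ ● ● ○ ∷ row ○ ● ● ○ ∷ row ○ ○ ○ ○ ∷ row ○ _ _ ○ ∷ []) H =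
  refute H a (path c b ③ ④) (path c b ② ①) (path c b ② ①)
classify (row ○ ● ● ○ ∷ row ○ ● ● ○ ∷ row ○ ○ ● ○ ∷ row ○ _ _ ○ ∷ []) H =
  refute H ④ (path a ② b c) (path c ③ ② ①) (path c b ② ①)
classify (row ○ ● ● ○ ∷ row ○ ● ● ○ ∷ row ○ ● ○ ○ ∷ row ○ _ _ ○ ∷ []) H =
  refute H ① (path a ③ b c) (path c ② ③ ④) (path c b ③ ④)
classify (row ○ ● ● ○ ∷ row ○ ● ● ○ ∷ row ○ ● ● ○ ∷ row ○ ○ _ ○ ∷ []) H =
  refute H b (path a ② c d) (path a ② c d) (path a ② c d)
classify (row ○ ● ● ○ ∷ row ○ ● ● ○ ∷ row ○ ● ● ○ ∷ row ○ ● ○ ○ ∷ []) H =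
  refute H b (path a ③ c d) (path a ③ c d) (path a ③ c d)
classify crossB′ _ = inj₂ (inj₁ crossB′≅graphB)
classify (row ○ ● ● ○ ∷ row ○ ● ● ○ ∷ row ○ _ _ ○ ∷ row ○ _ _ ● ∷ []) H =
  refute H a (path b c d ④) (path b c d ④) (path b c d ④)
classify (row ○ ● ● ○ ∷ row ○ ● ● ○ ∷ row ○ _ _ ● ∷ row ○ _ _ _ ∷ []) H =
  refute H d (path a b c ④) (path a b c ④) (path a b c ④)
classify (row ○ ● ● ○ ∷ row ○ ● _ ● ∷ row ○ _ _ _ ∷ row ○ _ _ _ ∷ []) H =
  refute H ③ (path a ② b ④) (path ① ② b ④) (path ① ② b ④)
classify (row ○ ● ● ○ ∷ row ○ _ _ _ ∷ row ○ _ _ _ ∷ row ● _ _ _ ∷ []) H =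
  refute H a (path b c d ①) (path b c d ①) (path b c d ①)
classify (row ○ ● ● ○ ∷ row ○ _ _ _ ∷ row ● _ _ _ ∷ row _ _ _ _ ∷ []) H =
  refute H d (path a b c ①) (path a b c ①) (path a b c ①)
classify (row ○ ● ● ○ ∷ row ● _ ○ _ ∷ row _ _ _ _ ∷ row _ _ _ _ ∷ []) H =
  refute H c (path ① b a ③) (path ① b a ③) (path ① b a ③)
classify (row ○ ● ● ○ ∷ row ● _ ● ○ ∷ row _ _ _ _ ∷ row _ _ _ _ ∷ []) H =
  refute H ② (path a ③ b ①) (path ① b ③ ④) (path ① b ③ ④)
classify (row ○ ● ● ○ ∷ row ● ○ ● ● ∷ row _ _ _ _ ∷ row _ _ _ _ ∷ []) H =
  refute H a (path ① b ③ ②) (path ② ① b ③) (path ② ① b ④)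
classify (row ○ ● ● ○ ∷ row ● ● ● ● ∷ row ○ _ _ _ ∷ row ○ _ _ _ ∷ []) H =
  refute H a (path d c b ①) (path d c b ①) (path d c b ①)
classify (row ○ ● ● ○ ∷ row ● ● ● ● ∷ row ● ○ _ _ ∷ row ○ _ _ _ ∷ []) H =
  refute H ③ (path a ② b c) (path a b ① c) (path a ② ① c)
classify (row ○ ● ● ○ ∷ row ● ● ● ● ∷ row ● ● ○ ○ ∷ row ○ _ _ _ ∷ []) H =
  refute H ① (path a ② b ④) (path c ② b ④) (path c ② ③ ④)
classify (row ○ ● ● ○ ∷ row ● ● ● ● ∷ row ● ● ○ ● ∷ row ○ _ _ _ ∷ []) H =
  refute H a (path ① c ② ③) (path ① c ④ ③) (path ③ ② c ④)
classify (row ○ ● ● ○ ∷ row ● ● ● ● ∷ row ● ● ● _ ∷ row ○ _ _ _ ∷ []) H =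
  refute H b (path a ② c ①) (path a ③ c ①) (path a ③ c ①)
classify (row ○ ● ● ○ ∷ row ● ● ● ● ∷ row _ _ _ _ ∷ row ● _ _ _ ∷ []) H =
  refute H c (path a b ① d) (path a b ① d) (path a b ① d)
classify (row ○ ● _ ● ∷ row _ _ _ _ ∷ row _ _ _ _ ∷ row _ _ _ _ ∷ []) H =
  refute H ③ (path ① ② a ④) (path ① ② a ④) (path ① ② a ④)
classify (row ● ○ ○ _ ∷ row _ _ _ _ ∷ row _ _ _ _ ∷ row _ _ _ _ ∷ []) H =
  refute H ④ (path a ① ② ③) (path a ① ② ③) (path a ① ② ③)
classify (row ● ○ ● ○ ∷ row _ _ _ _ ∷ row _ _ _ _ ∷ row _ _ _ _ ∷ []) H =
  refute H ② (path ① a ③ ④) (path ① a ③ ④) (path ① a ③ ④)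
classify (row ● ○ ● ● ∷ row _ _ _ _ ∷ row _ _ _ _ ∷ row _ _ _ _ ∷ []) H =
  refute H b (path ① a ③ ②) (path ② ① a ③) (path ② ① a ④)
classify (row ● ● ○ ○ ∷ row _ _ _ _ ∷ row _ _ _ _ ∷ row _ _ _ _ ∷ []) H =
  refute H ① (path a ② ③ ④) (path a ② ③ ④) (path a ② ③ ④)
classify (row ● ● ○ ● ∷ row _ _ _ _ ∷ row _ _ _ _ ∷ row _ _ _ _ ∷ []) H =
  refute H b (path ① a ② ③) (path ① a ④ ③) (path ③ ② a ④)
classify (row ● ● ● ○ ∷ row _ _ _ _ ∷ row _ _ _ _ ∷ row _ _ _ _ ∷ []) H =
  refute H ② (path ① a ③ ④) (path ① a ③ ④) (path ① a ③ ④)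
classify (row ● ● ● ● ∷ row ○ _ _ _ ∷ row ○ _ _ _ ∷ row _ _ _ _ ∷ []) H =
  refute H d (path c b a ①) (path c b a ①) (path c b a ①)
classify (row ● ● ● ● ∷ row ○ _ _ _ ∷ row ● _ _ _ ∷ row ○ _ _ _ ∷ []) H =
  refute H b (path a ① c d) (path a ① c d) (path a ① c d)
classify (row ● ● ● ● ∷ row ○ _ _ _ ∷ row ● _ _ _ ∷ row ● _ _ _ ∷ []) H =
  refute H c (path b a ① d) (path b a ① d) (path b a ① d)
classify (row ● ● ● ● ∷ row ● ○ ○ _ ∷ row _ _ _ _ ∷ row _ _ _ _ ∷ []) H =
  refute H ④ (path b ① a ③) (path b ① ② ③) (path b ① ② ③)
classify (row ● ● ● ● ∷ row ● ○ ● ○ ∷ row _ _ _ _ ∷ row _ _ _ _ ∷ []) H =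
  refute H ② (path b ① a ④) (path ① b ③ ④) (path ① b ③ ④)
classify (row ● ● ● ● ∷ row ● ○ ● ● ∷ row _ _ _ _ ∷ row _ _ _ _ ∷ []) H =
  refute H a (path ① b ③ ②) (path ② ① b ③) (path ② ① b ④)
classify (row ● ● ● ● ∷ row ● ● ○ ○ ∷ row _ _ _ _ ∷ row _ _ _ _ ∷ []) H =
  refute H ① (path b ② a ④) (path b ② ③ ④) (path b ② ③ ④)
classify (row ● ● ● ● ∷ row ● ● ○ ● ∷ row _ _ _ _ ∷ row _ _ _ _ ∷ []) H =
  refute H a (path ① b ② ③) (path ① b ④ ③) (path ③ ② b ④)
classify (row ● ● ● ● ∷ row ● ● ● ○ ∷ row _ _ _ _ ∷ row _ _ _ _ ∷ []) H =
  refute H ② (path b ① a ④) (path ① b ③ ④) (path ① b ③ ④)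
classify (row ● ● ● ● ∷ row ● ● ● ● ∷ row ○ _ _ _ ∷ row ○ _ _ _ ∷ []) H =
  refute H a (path d c b ①) (path d c b ①) (path d c b ①)
classify (row ● ● ● ● ∷ row ● ● ● ● ∷ row ○ _ _ _ ∷ row ● _ _ _ ∷ []) H =
  refute H b (path a ① d c) (path a ① d c) (path a ① d c)
classify (row ● ● ● ● ∷ row ● ● ● ● ∷ row ● _ ○ _ ∷ row _ _ _ _ ∷ []) H =
  refute H b (path c ① a ③) (path c ① a ③) (path c ① a ③)
classify (row ● ● ● ● ∷ row ● ● ● ● ∷ row ● _ ● ○ ∷ row _ _ _ _ ∷ []) H =
  refute H b (path c ① a ④) (path c ① a ④) (path c ① a ④)
classify (row ● ● ● ● ∷ row ● ● ● ● ∷ row ● ○ ● ● ∷ row _ _ _ _ ∷ []) H =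
  refute H a (path ① c ③ ②) (path ② ① c ③) (path ② ① c ④)
classify (row ● ● ● ● ∷ row ● ● ● ● ∷ row ● ● ● ● ∷ row ○ _ _ _ ∷ []) H =
  refute H b (path a ① c d) (path a ① c d) (path a ① c d)
classify (row ● ● ● ● ∷ row ● ● ● ● ∷ row ● ● ● ● ∷ row ● ○ _ _ ∷ []) H =
  refute H b (path a ② c d) (path a ② c d) (path a ② c d)
classify (row ● ● ● ● ∷ row ● ● ● ● ∷ row ● ● ● ● ∷ row ● ● ○ _ ∷ []) H =
  refute H a (path d ① b ③) (path d ① b ③) (path d ① b ③)
classify (row ● ● ● ● ∷ row ● ● ● ● ∷ row ● ● ● ● ∷ row ● ● ● ○ ∷ []) H =
  refute H a (path d ① b ④) (path d ① b ④) (path d ① b ④)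
classify crossC _ = inj₂ (inj₂ crossC≅graphC)

[,]-injective : {f g : Fin K → Fin N} → Injective _≡_ _≡_ f → Injective _≡_ _≡_ g →
                (∀ i j → f i ≢ g j) → Injective _≡_ _≡_ Sum.[ f , g ]′
[,]-injective f-inj g-inj disjoint {inj₁ i} {inj₁ j} eq = cong inj₁ (f-inj eq)
[,]-injective f-inj g-inj disjoint {inj₁ i} {inj₂ j} eq = ⊥-elim (disjoint i j eq)
[,]-injective f-inj g-inj disjoint {inj₂ i} {inj₁ j} eq = ⊥-elim (disjoint j i (sym eq))
[,]-injective f-inj g-inj disjoint {inj₂ i} {inj₂ j} eq = cong inj₂ (g-inj eq)

splitAt-injective : ∀ K {N} → Injective _≡_ _≡_ (splitAt K {N})
splitAt-injective K {N} {x} {y} eq =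
  trans (sym (join-splitAt K N x)) (trans (cong (join K N) eq) (join-splitAt K N y))

joinP4s : (Fin 4 → Fin N) → (Fin 4 → Fin N) → Fin 8 → Fin N
joinP4s f g x = Sum.[ f , g ]′ (splitAt 4 x)

crossOf : Adj N → (Fin 4 → Fin N) → (Fin 4 → Fin N) → Cross
crossOf A f g = tabulate λ i → tabulate λ j → A (f i) (g j)

module _ (G : Graph) {f g : Fin 4 → Fin (n G)}
         (f-copy : InducedCopy (adj G) P4adj f) (g-copy : InducedCopy (adj G) P4adj g) where

  entry-crossOf : ∀ i j → entry (crossOf (adj G) f g) i j ≡ adj G (f i) (g j)
  entry-crossOf i j =
    trans (cong (λ r → lookup r j) (lookup∘tabulate (λ p → tabulate λ q → adj G (f p) (g q)) i))
          (lookup∘tabulate (λ q → adj G (f i) (g q)) j)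

  joinP4s-injective : (∀ i j → f i ≢ g j) → Injective _≡_ _≡_ (joinP4s f g)
  joinP4s-injective disjoint eq =
    splitAt-injective 4 ([,]-injective (proj₁ f-copy) (proj₁ g-copy) disjoint eq)

  joinP4s-adj : ∀ x y → adj G (joinP4s f g x) (joinP4s f g y) ≡ twoP4s (crossOf (adj G) f g) x y
  joinP4s-adj x y = adj⊎ (splitAt 4 x) (splitAt 4 y)
    where
    adj⊎ : ∀ s t → adj G (Sum.[ f , g ]′ s) (Sum.[ f , g ]′ t) ≡ twoP4s⊎ (crossOf (adj G) f g) s t
    adj⊎ (inj₁ i) (inj₁ j) = proj₂ f-copy i j
    adj⊎ (inj₂ i) (inj₂ j) = proj₂ g-copy i j
    adj⊎ (inj₁ i) (inj₂ j) = sym (entry-crossOf i j)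
    adj⊎ (inj₂ j) (inj₁ i) = trans (Graph.sym G (g j) (f i)) (sym (entry-crossOf i j))

proposition3p5 : (G : Graph) → ForbiddenEdgeApex G → TwoDisjointInducedP4 G →
    (G ≅ graphA) ⊎ (G ≅ graphB) ⊎ (G ≅ graphC)
proposition3p5 G (_ , minimal) (f , g , f-copy , g-copy , disjoint) =
  Sum.map (via graphA) (Sum.map (via graphB) (via graphC)) (classify M deletable)
  where
  M : Cross
  M = crossOf (adj G) f g
  h : Fin 8 → Fin (n G)
  h = joinP4s f g
  h-inj : Injective _≡_ _≡_ h
  h-inj = joinP4s-injective G f-copy g-copy disjoint
  h-adj : ∀ x y → adj G (h x) (h y) ≡ twoP4s M x y
  h-adj = joinP4s-adj G f-copy g-copy
  n≤8 : n G ≤ 8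
  n≤8 = ≮⇒≥ λ 8<n → ¬edgeApex-twoP4s M (edgeApex-resp h-adj (minimal 8 8<n h h-inj))
  via : ∀ J → twoP4sGraph M ≅ J → G ≅ J
  via J = ≅-trans {G} {twoP4sGraph M} {J}
            (≅-sym {twoP4sGraph M} {G} (embedding⇒≅ (twoP4sGraph M) G h h-inj n≤8 h-adj))
  deletable : ∀ x → EdgeApexCographAdj (twoP4s M ∖ x)
  deletable x =
    edgeApex-resp (λ i j → h-adj (punchIn x i) (punchIn x j))
      (minimal 7 (injective⇒≤ {f = h} h-inj) (h ∘ punchIn x)
               (λ eq → punchIn-injective x _ _ (h-inj eq)))
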